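{- Let $\lambda_1,n,k$ be positive integers. Suppose there exists a $\mathrm{DK}(\lambda_1 n,\lambda_1^2)$-design $\mathcal{D}=(\mathcal{V},\mathcal{B})$ with $|\mathcal{V}|=k$ and $|\mathcal{B}|=n^2$, with set of block sizes $\mathcal{K}=\{|b|:b\in\mathcal{B}\}$, such that $\mathcal{B}$ has two orthogonal equipartitions of type $n^n$ in which each point occurs $\lambda_1$ times in each part. Suppose furthermore that there is a positive integer $w$ such that: (1) every element of $\mathcal{K}$ is congruent to $w-1$ modulo $w$; (2) either $\lambda_1$ or $n+(k-1)\lambda_1$ is coprime to $w$; (3) $n\not\equiv 0\pmod w$. Then there exists a type-maximal set of $k$ mutually orthogonal binary frequency squares of type $(n+k\lambda_1;\,n+(k-1)\lambda_1,\,\lambda_1)$.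
   Context: A design is a pair $(\mathcal{V},\mathcal{B})$ with $\mathcal{V}$ a finite set of points and $\mathcal{B}$ a collection (multiset; repeated and empty blocks allowed) of subsets of $\mathcal{V}$. For positive integers $R,\Lambda$, a $\mathrm{DK}(R,\Lambda)$-design is a design in which every pair of distinct points occurs in exactly $\Lambda$ blocks, every point occurs in exactly $R$ blocks, and $R^2=\Lambda|\mathcal{B}|$. A partition of $\mathcal{B}$ (blocks counted with multiplicity) is an equipartition if each point occurs the same number of times among the blocks of each part; two partitions $\mathcal{P}_1,\mathcal{P}_2$ of $\mathcal{B}$ are orthogonal if $|P_1\cap P_2|\le1$ for all parts $P_1\in\mathcal{P}_1,P_2\in\mathcal{P}_2$; type $n^n$ means $n$ parts each of cardinality $n$. A frequency square of type $(N;\mu_0,\dots,\mu_{m-1})$ ($m\ge2$, $\mu_i\ge1$) is an $N\times N$ array on symbols $\{0,\dots,m-1\}$ where symbol $i$ occurs exactly $\mu_i$ times in each row and column; binary means $m=2$. Two frequency squares of types $(N;\mu_0,\dots)$ and $(N;\nu_0,\dots)$ are orthogonal if each ordered pair $(i,j)$ occurs exactly $\mu_i\nu_j$ times when superimposed. A set $\{F_1,\dots,F_k\}$ of mutually (pairwise) orthogonal frequency squares is type-maximal if there is no frequency square $F$ orthogonal to every $F_i$ and of the same type as some $F_t$. -}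

module Defs where

open import Data.Nat using (ℕ; zero; suc; _+_; _*_; _∸_; _≤_; _%_)
open import Data.Bool using (Bool; true; false; _∧_)
open import Data.Fin using (Fin; zero; suc; _≟_)
open import Data.Fin.Subset using (Subset; ∣_∣)
open import Data.Vec using (lookup)
open import Data.Product using (Σ; ∃; _×_; _,_)
open import Relation.Nullary using (¬_; does)
open import Relation.Binary.PropositionalEquality using (_≡_; _≢_)

count : ∀ {n} → (Fin n → Bool) → ℕ
count {zero}  p = 0
count {suc n} p with p zero
... | true  = suc (count (λ i → p (suc i)))
... | false = count (λ i → p (suc i))

_==_ : ∀ {n} → Fin n → Fin n → Bool
i == j = does (i ≟ j)

-- a ≡ b (mod w); (mod 0 means equality, only used with w ≥ 1)
ModEq : ℕ → ℕ → ℕ → Set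
ModEq zero    a b = a ≡ b
ModEq (suc w) a b = a % suc w ≡ b % suc w

-- Designs: point set Fin k, block collection indexed by Fin b
-- (a multiset: blocks may repeat, and may be empty).

Blocks : ℕ → ℕ → Set
Blocks k b = Fin b → Subset k

_∈B_ : ∀ {k} → Fin k → Subset k → Bool
x ∈B s = lookup s x

record IsDK {k b : ℕ} (R Λ : ℕ) (B : Blocks k b) : Set where
  field
    replication : ∀ (x : Fin k) → count (λ i → x ∈B B i) ≡ R
    pairs       : ∀ (x y : Fin k) → x ≢ y →
                  count (λ i → (x ∈B B i) ∧ (y ∈B B i)) ≡ Λ
    sizeEq      : R * R ≡ Λ * b

-- A partition of the blocks into parts indexed by Fin m is given by
-- the part-assignment function π : Fin b → Fin m.
-- Type n^n : n parts each of cardinality n.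
IsTypeNN : ∀ {n} → (Fin (n * n) → Fin n) → Set
IsTypeNN {n} π = ∀ (p : Fin n) → count (λ i → π i == p) ≡ n

IsEquipartitionWith : ∀ {k b m} → ℕ → Blocks k b → (Fin b → Fin m) → Set
IsEquipartitionWith {k} {b} {m} λ₁ B π =
  ∀ (p : Fin m) (x : Fin k) → count (λ i → (π i == p) ∧ (x ∈B B i)) ≡ λ₁

OrthogonalPartitions : ∀ {b m m'} → (Fin b → Fin m) → (Fin b → Fin m') → Set
OrthogonalPartitions {b} {m} {m'} π₁ π₂ =
  ∀ (p : Fin m) (q : Fin m') → count (λ i → (π₁ i == p) ∧ (π₂ i == q)) ≤ 1

Square : ℕ → ℕ → Set
Square N m = Fin N → Fin N → Fin m

sumFin : ∀ {n} → (Fin n → ℕ) → ℕ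
sumFin {zero}  f = 0
sumFin {suc n} f = f zero + sumFin (λ i → f (suc i))

countCells : ∀ {N} → (Fin N → Fin N → Bool) → ℕ
countCells p = sumFin (λ r → count (λ c → p r c))

record IsFreqSquare (N m : ℕ) (μ : Fin m → ℕ) (F : Square N m) : Set where
  field
    atLeastTwo : 2 ≤ m
    positive   : ∀ (i : Fin m) → 1 ≤ μ i
    rows       : ∀ (r : Fin N) (i : Fin m) → count (λ c → F r c == i) ≡ μ i
    cols       : ∀ (c : Fin N) (i : Fin m) → count (λ r → F r c == i) ≡ μ i

OrthogonalSq : ∀ {N m m'} → (Fin m → ℕ) → (Fin m' → ℕ) →
               Square N m → Square N m' → Set
OrthogonalSq {N} {m} {m'} μ ν F G =
  ∀ (i : Fin m) (j : Fin m') →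
    countCells (λ r c → (F r c == i) ∧ (G r c == j)) ≡ μ i * ν j

record IsMOBFS (k N : ℕ) (μs : Fin k → Fin 2 → ℕ) (F : Fin k → Square N 2) : Set where
  field
    freq : ∀ (t : Fin k) → IsFreqSquare N 2 (μs t) (F t)
    orth : ∀ (s t : Fin k) → s ≢ t → OrthogonalSq (μs s) (μs t) (F s) (F t)

-- Type-maximal: no frequency square orthogonal to every F t and of the same
-- type as some F t (same type forces binary, with the same frequencies).
TypeMaximal : ∀ {k N} → (Fin k → Fin 2 → ℕ) → (Fin k → Square N 2) → Set
TypeMaximal {k} {N} μs F =
  ¬ (Σ (Square N 2) λ G → Σ (Fin k) λ t →
       IsFreqSquare N 2 (μs t) G × (∀ (s : Fin k) → OrthogonalSq (μs t) (μs s) G (F s)))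

binType : ℕ → ℕ → Fin 2 → ℕ
binType a b zero       = a
binType a b (suc zero) = b

{-# OPTIONS --safe #-}
-- Orthogonality of the two equipartitions identifies the n² blocks with the cells of an
-- n × n grid: block (p , q) is the unique block in part p of the first partition and
-- part q of the second. For each point x, the square F_x of order n + kλ₁ has a 1 at
-- (p , q) in its top-left n × n corner iff x lies in block (p , q), and in its bottom-right
-- kλ₁ × kλ₁ corner it marks the symbol x of a cyclic Latin square of order k whose cells
-- are inflated to λ₁ × λ₁ blocks. The equipartition and pair conditions make these k squares
-- mutually orthogonal.
--
-- If G were another square of this type orthogonal to all F_x, summing the orthogonality
-- relations over x and comparing with the row and column sums of G would give
-- Σ G(p , q) (|B(p , q)| + 1) = nλ₁ over the top-left corner. Since w divides every |b| + 1,
-- w ∣ nλ₁; double counting incidences gives w ∣ n(n + kλ₁) as well, so w ∣ n(n + (k - 1)λ₁),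
-- and either coprimality hypothesis forces w ∣ n.
module Submission where

open import Data.Bool using (Bool; true; false; _∧_)
open import Data.Fin using (Fin; zero; suc; toℕ; _≟_; _↑ˡ_; _↑ʳ_; splitAt; join; combine; quotient; punchIn)
open import Data.Fin.Properties
  using (join-splitAt; splitAt-↑ˡ; splitAt-↑ʳ; remQuot-combine; toℕ-fromℕ<; toℕ-injective; toℕ<n)
open import Data.Fin.Subset using (Subset; ∣_∣)
open import Data.Nat using (ℕ; zero; suc; _+_; _*_; _∸_; _≤_; z≤n; s≤s; NonZero; _%_)
open import Data.Nat.Coprimality using (Coprime; coprime-divisor) renaming (sym to ⊥-sym)
open import Data.Nat.Divisibility using (_∣_; divides; ∣-refl; _∣0; ∣m∣n⇒∣m+n; ∣m+n∣m⇒∣n; ∣m⇒∣m*n; n∣m⇒m%n≡0)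
open import Data.Nat.DivMod
  using (_mod_; _/_; m≡m%n+[m/n]*n; %-distribˡ-+; m%n%n≡m%n; %-remove-+ˡ; m<n⇒m%n≡m; m%n<n)
open import Data.Nat.Properties hiding (_≟_)
open import Algebra.Properties.CommutativeSemigroup *-commutativeSemigroup using (x∙yz≈y∙xz)
open import Algebra.Properties.Semiring.Sum +-*-semiring
  using (sum; sum-syntax; sum-cong-≗; ∑-distrib-+; ∑-comm; *-distribˡ-sum; *-distribʳ-sum;
         sum-remove; sum-replicate-zero)
open import Data.Nat.Tactic.RingSolver using (solve-∀)
open import Data.Product using (Σ; ∃; _×_; _,_; proj₁; proj₂)
open import Data.Sum using (_⊎_; inj₁; inj₂; [_,_]; [_,_]′)
open import Data.Vec using ([]; _∷_)
open import Data.Vec.Functional using (removeAt)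
open import Function using (_∘_; flip)
open import Function.Bundles using (mk⇔)
open import Relation.Binary.PropositionalEquality hiding ([_])
open import Relation.Nullary using (¬_; contradiction; Dec; yes; no; does)
open import Relation.Nullary.Decidable using (dec-true; dec-false; does-⇔; _×-dec_)

open import Defs

⟦_⟧ : Bool → ℕ
⟦ true ⟧  = 1
⟦ false ⟧ = 0

⟦∧⟧ : ∀ a b → ⟦ a ∧ b ⟧ ≡ ⟦ a ⟧ * ⟦ b ⟧
⟦∧⟧ true  b = sym (+-identityʳ ⟦ b ⟧)
⟦∧⟧ false b = refl

dec-true⁻¹ : ∀ {a} {A : Set a} (a? : Dec A) → does a? ≡ true → A
dec-true⁻¹ (yes a) _ = a

==-disjoint : ∀ {n} (y : Fin n) {s t} → s ≢ t → ⟦ y == s ⟧ * ⟦ y == t ⟧ ≡ 0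
==-disjoint y {s} {t} s≢t with y ≟ s
... | no  _    = refl
... | yes refl rewrite dec-false (y ≟ t) s≢t = refl

sumFin≡∑ : ∀ {n} (f : Fin n → ℕ) → sumFin f ≡ sum f
sumFin≡∑ {zero}  f = refl
sumFin≡∑ {suc n} f = cong (f zero +_) (sumFin≡∑ (f ∘ suc))

count≡∑ : ∀ {n} (p : Fin n → Bool) → count p ≡ sum (⟦_⟧ ∘ p)
count≡∑ {zero}  p = refl
count≡∑ {suc n} p with p zero
... | true  = cong suc (count≡∑ (p ∘ suc))
... | false = count≡∑ (p ∘ suc)

countCells≡∑∑ : ∀ {N} (p : Fin N → Fin N → Bool) → countCells p ≡ ∑[ r < N ] ∑[ c < N ] ⟦ p r c ⟧
countCells≡∑∑ p = trans (sumFin≡∑ (λ r → count (p r))) (sum-cong-≗ (λ r → count≡∑ (p r)))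

∑-const : ∀ n c → sum {n} (λ _ → c) ≡ n * c
∑-const zero    c = refl
∑-const (suc n) c = cong (c +_) (∑-const n c)

∑-≤ : ∀ {n} {c} (f : Fin n → ℕ) → (∀ i → f i ≤ c) → sum f ≤ n * c
∑-≤ {zero}  f f≤c = z≤n
∑-≤ {suc n} f f≤c = +-mono-≤ (f≤c zero) (∑-≤ (f ∘ suc) (f≤c ∘ suc))

term≤∑ : ∀ {n} (f : Fin n → ℕ) i → f i ≤ sum f
term≤∑ {suc n} f i = ≤-trans (m≤m+n (f i) _) (≤-reflexive (sym (sum-remove {i = i} f)))

∑-∣ : ∀ {n d} (f : Fin n → ℕ) → (∀ i → d ∣ f i) → d ∣ sum f
∑-∣ {zero}  f d∣f = _ ∣0
∑-∣ {suc n} f d∣f = ∣m∣n⇒∣m+n (d∣f zero) (∑-∣ (f ∘ suc) (d∣f ∘ suc))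

∑-↑ : ∀ n {m} (f : Fin (n + m) → ℕ) →
      sum f ≡ sum (λ i → f (i ↑ˡ m)) + sum (λ j → f (n ↑ʳ j))
∑-↑ zero    f = refl
∑-↑ (suc n) f = trans (cong (f zero +_) (∑-↑ n (f ∘ suc))) (sym (+-assoc (f zero) _ _))

∑-combine : ∀ m {n} (f : Fin (m * n) → ℕ) →
            sum f ≡ ∑[ i < m ] ∑[ j < n ] f (combine i j)
∑-combine zero        f = refl
∑-combine (suc m) {n} f =
  trans (∑-↑ n f) (cong (sum (λ j → f (j ↑ˡ (m * n))) +_) (∑-combine m (f ∘ (n ↑ʳ_))))

∑-quotient : ∀ m n (f : Fin m → ℕ) → sum (f ∘ quotient {m} n) ≡ n * sum f
∑-quotient m n f = begin
  sum (f ∘ quotient n)                                ≡⟨ ∑-combine m (f ∘ quotient n) ⟩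
  ∑[ i < m ] ∑[ j < n ] f (quotient n (combine i j)) ≡⟨ sum-cong-≗ (λ i → sum-cong-≗ (λ j →
                                                           cong (f ∘ proj₁) (remQuot-combine {m} {n} i j))) ⟩
  ∑[ i < m ] ∑[ j < n ] f i                           ≡⟨ sum-cong-≗ (λ i → ∑-const n (f i)) ⟩
  ∑[ i < m ] (n * f i)                                ≡⟨ *-distribˡ-sum n f ⟨
  n * sum f                                           ∎
  where open ≡-Reasoning

∑-δ : ∀ {n} (i : Fin n) (h : Fin n → ℕ) → sum (λ j → ⟦ i == j ⟧ * h j) ≡ h i
∑-δ {suc n} zero    h = trans (cong₂ _+_ (+-identityʳ (h zero)) (sum-replicate-zero n)) (+-identityʳ (h zero))
∑-δ {suc n} (suc i) h = ∑-δ i (h ∘ suc)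

∑-δ₁ : ∀ {n} (i : Fin n) → sum (λ j → ⟦ i == j ⟧) ≡ 1
∑-δ₁ i = trans (sum-cong-≗ (λ j → sym (*-identityʳ ⟦ i == j ⟧))) (∑-δ i (λ _ → 1))

∑-fibres : ∀ {m n} (π : Fin m → Fin n) (h : Fin m → ℕ) →
           ∑[ q < n ] ∑[ i < m ] (⟦ π i == q ⟧ * h i) ≡ sum h
∑-fibres π h = trans (∑-comm (λ q i → ⟦ π i == q ⟧ * h i))
                     (sum-cong-≗ (λ i → ∑-δ (π i) (λ _ → h i)))

∑-pull-weight : ∀ {k a b} (f : Fin k → Fin a → Fin b → ℕ) (h : Fin a → Fin b → ℕ) →
  ∑[ s < k ] ∑[ p < a ] ∑[ q < b ] (f s p q * h p q) ≡ ∑[ p < a ] ∑[ q < b ] (∑[ s < k ] f s p q * h p q)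
∑-pull-weight {k} {a} {b} f h = begin
  ∑[ s < k ] ∑[ p < a ] ∑[ q < b ] (f s p q * h p q) ≡⟨ ∑-comm (λ s p → ∑[ q < b ] (f s p q * h p q)) ⟩
  ∑[ p < a ] ∑[ s < k ] ∑[ q < b ] (f s p q * h p q) ≡⟨ sum-cong-≗ (λ p → ∑-comm (λ s q → f s p q * h p q)) ⟩
  ∑[ p < a ] ∑[ q < b ] ∑[ s < k ] (f s p q * h p q) ≡⟨ sum-cong-≗ (λ p → sum-cong-≗ (λ q →
                                                          *-distribʳ-sum (h p q) (λ s → f s p q))) ⟨
  ∑[ p < a ] ∑[ q < b ] (∑[ s < k ] f s p q * h p q) ∎
  where open ≡-Reasoning

∑∑-distrib-+ : ∀ {a b} (f g : Fin a → Fin b → ℕ) →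
  ∑[ r < a ] ∑[ c < b ] (f r c + g r c) ≡ ∑[ r < a ] ∑[ c < b ] f r c + ∑[ r < a ] ∑[ c < b ] g r c
∑∑-distrib-+ {a} {b} f g = trans (sum-cong-≗ λ r → ∑-distrib-+ (f r) (g r))
                                 (∑-distrib-+ (λ r → ∑[ c < b ] f r c) (λ r → ∑[ c < b ] g r c))

∑∑-↑ : ∀ n m (f : Fin (n + m) → Fin (n + m) → ℕ) →
       ∑[ r < n + m ] ∑[ c < n + m ] f r c ≡
         (∑[ p < n ] ∑[ q < n ] f (p ↑ˡ m) (q ↑ˡ m) + ∑[ p < n ] ∑[ b < m ] f (p ↑ˡ m) (n ↑ʳ b)) +
         (∑[ a < m ] ∑[ q < n ] f (n ↑ʳ a) (q ↑ˡ m) + ∑[ a < m ] ∑[ b < m ] f (n ↑ʳ a) (n ↑ʳ b))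
∑∑-↑ n m f = trans (∑-↑ n (λ r → ∑[ c < n + m ] f r c))
  (cong₂ _+_ (trans (sum-cong-≗ (λ p → ∑-↑ n (f (p ↑ˡ m))))
                    (∑-distrib-+ (λ p → ∑[ q < n ] f (p ↑ˡ m) (q ↑ˡ m)) (λ p → ∑[ b < m ] f (p ↑ˡ m) (n ↑ʳ b))))
             (trans (sum-cong-≗ (λ a → ∑-↑ n (f (n ↑ʳ a))))
                    (∑-distrib-+ (λ a → ∑[ q < n ] f (n ↑ʳ a) (q ↑ˡ m)) (λ a → ∑[ b < m ] f (n ↑ʳ a) (n ↑ʳ b)))))

all≤1∧∑≡n⇒all≡1 : ∀ {n} (f : Fin n → ℕ) → (∀ i → f i ≤ 1) → sum f ≡ n → ∀ i → f i ≡ 1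
all≤1∧∑≡n⇒all≡1 {suc n} f f≤1 ∑f≡n i = ≤-antisym (f≤1 i) (+-cancelʳ-≤ n 1 (f i) (begin
  1 + n                           ≡⟨ ∑f≡n ⟨
  sum f                           ≡⟨ sum-remove {i = i} f ⟩
  f i + sum (removeAt f i)        ≤⟨ +-monoʳ-≤ (f i) (∑-≤ (removeAt f i) (f≤1 ∘ punchIn i)) ⟩
  f i + n * 1                     ≡⟨ cong (f i +_) (*-identityʳ n) ⟩
  f i + n                         ∎))
  where open ≤-Reasoning

true⇒1≤∑⟦⟧ : ∀ {n} (p : Fin n → Bool) {i} → p i ≡ true → 1 ≤ sum (⟦_⟧ ∘ p)
true⇒1≤∑⟦⟧ p {i} pi = ≤-trans (≤-reflexive (cong ⟦_⟧ (sym pi))) (term≤∑ (⟦_⟧ ∘ p) i)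

1≤∑⟦⟧⇒∃ : ∀ {n} (p : Fin n → Bool) → 1 ≤ sum (⟦_⟧ ∘ p) → ∃ λ i → p i ≡ true
1≤∑⟦⟧⇒∃ {suc n} p pos with p zero in pz
... | true  = zero , pz
... | false = let i , pi = 1≤∑⟦⟧⇒∃ (p ∘ suc) pos in suc i , pi

∑⟦⟧≤1⇒unique : ∀ {n} (p : Fin n → Bool) → sum (⟦_⟧ ∘ p) ≤ 1 →
                 ∀ {i j} → p i ≡ true → p j ≡ true → i ≡ j
∑⟦⟧≤1⇒unique {suc n} p ≤1 {zero}  {zero}  pi pj = refl
∑⟦⟧≤1⇒unique {suc n} p ≤1 {zero}  {suc j} pi pj =
  contradiction (≤-trans (+-mono-≤ (≤-reflexive (cong ⟦_⟧ (sym pi))) (true⇒1≤∑⟦⟧ (p ∘ suc) pj)) ≤1) (1+n≰n {1})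
∑⟦⟧≤1⇒unique {suc n} p ≤1 {suc i} {zero}  pi pj = sym (∑⟦⟧≤1⇒unique p ≤1 pj pi)
∑⟦⟧≤1⇒unique {suc n} p ≤1 {suc i} {suc j} pi pj =
  cong suc (∑⟦⟧≤1⇒unique (p ∘ suc) (≤-trans (m≤n+m _ ⟦ p zero ⟧) ≤1) pi pj)

module OrthogonalGrid {n} (π₁ π₂ : Fin (n * n) → Fin n)
  (type₁ : IsTypeNN π₁) (orth : OrthogonalPartitions π₁ π₂) where

  inCell : Fin n → Fin n → Fin (n * n) → Bool
  inCell p q i = (π₁ i == p) ∧ (π₂ i == q)

  private
    cellSize≤1 : ∀ p q → sum (⟦_⟧ ∘ inCell p q) ≤ 1
    cellSize≤1 p q = subst (_≤ 1) (count≡∑ (inCell p q)) (orth p q)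

    rowSize : ∀ p → ∑[ q < n ] sum (⟦_⟧ ∘ inCell p q) ≡ n
    rowSize p = begin
      ∑[ q < n ] ∑[ i < n * n ] ⟦ inCell p q i ⟧                 ≡⟨ sum-cong-≗ (sum-cong-≗ ∘ swap) ⟩
      ∑[ q < n ] ∑[ i < n * n ] (⟦ π₂ i == q ⟧ * ⟦ π₁ i == p ⟧) ≡⟨ ∑-fibres π₂ (λ i → ⟦ π₁ i == p ⟧) ⟩
      ∑[ i < n * n ] ⟦ π₁ i == p ⟧                               ≡⟨ count≡∑ (λ i → π₁ i == p) ⟨
      count (λ i → π₁ i == p)                                    ≡⟨ type₁ p ⟩
      n                                                          ∎
      where
      open ≡-Reasoning
      swap : ∀ q i → ⟦ inCell p q i ⟧ ≡ ⟦ π₂ i == q ⟧ * ⟦ π₁ i == p ⟧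
      swap q i = trans (⟦∧⟧ (π₁ i == p) (π₂ i == q)) (*-comm ⟦ π₁ i == p ⟧ ⟦ π₂ i == q ⟧)

    cellSize≡1 : ∀ p q → sum (⟦_⟧ ∘ inCell p q) ≡ 1
    cellSize≡1 p = all≤1∧∑≡n⇒all≡1 _ (cellSize≤1 p) (rowSize p)

    blockInCell : ∀ p q → ∃ λ i → inCell p q i ≡ true
    blockInCell p q = 1≤∑⟦⟧⇒∃ (inCell p q) (≤-reflexive (sym (cellSize≡1 p q)))

  block : Fin n → Fin n → Fin (n * n)
  block p q = proj₁ (blockInCell p q)

  π-block : ∀ p q → π₁ (block p q) ≡ p × π₂ (block p q) ≡ q
  π-block p q = dec-true⁻¹ ((π₁ _ ≟ p) ×-dec (π₂ _ ≟ q)) (proj₂ (blockInCell p q))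

  block-unique : ∀ {p q i} → π₁ i ≡ p → π₂ i ≡ q → block p q ≡ i
  block-unique {p} {q} {i} π₁i≡p π₂i≡q = ∑⟦⟧≤1⇒unique (inCell p q) (cellSize≤1 p q)
    (proj₂ (blockInCell p q)) (dec-true ((π₁ i ≟ p) ×-dec (π₂ i ≟ q)) (π₁i≡p , π₂i≡q))

  inCell≡block== : ∀ p q i → inCell p q i ≡ (block p q == i)
  inCell≡block== p q i = does-⇔
    (mk⇔ (λ (e₁ , e₂) → block-unique e₁ e₂) (λ e → subst (λ j → π₁ j ≡ p × π₂ j ≡ q) e (π-block p q)))
    ((π₁ i ≟ p) ×-dec (π₂ i ≟ q)) (block p q ≟ i)

  ∑-cell : ∀ p q (h : Fin (n * n) → ℕ) →
           ∑[ i < n * n ] (⟦ π₁ i == p ⟧ * (⟦ π₂ i == q ⟧ * h i)) ≡ h (block p q)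
  ∑-cell p q h = begin
    ∑[ i < n * n ] (⟦ π₁ i == p ⟧ * (⟦ π₂ i == q ⟧ * h i)) ≡⟨ sum-cong-≗ (λ i → *-assoc ⟦ π₁ i == p ⟧ _ _) ⟨
    ∑[ i < n * n ] (⟦ π₁ i == p ⟧ * ⟦ π₂ i == q ⟧ * h i)   ≡⟨ sum-cong-≗ (λ i → cong (_* h i) (indicator i)) ⟩
    ∑[ i < n * n ] (⟦ block p q == i ⟧ * h i)              ≡⟨ ∑-δ (block p q) h ⟩
    h (block p q)                                          ∎
    where
    open ≡-Reasoning
    indicator : ∀ i → ⟦ π₁ i == p ⟧ * ⟦ π₂ i == q ⟧ ≡ ⟦ block p q == i ⟧
    indicator i = trans (sym (⟦∧⟧ (π₁ i == p) (π₂ i == q))) (cong ⟦_⟧ (inCell≡block== p q i))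

  ∑-part₁ : ∀ p (h : Fin (n * n) → ℕ) → ∑[ i < n * n ] (⟦ π₁ i == p ⟧ * h i) ≡ ∑[ q < n ] h (block p q)
  ∑-part₁ p h = begin
    ∑[ i < n * n ] (⟦ π₁ i == p ⟧ * h i)                              ≡⟨ ∑-fibres π₂ _ ⟨
    ∑[ q < n ] ∑[ i < n * n ] (⟦ π₂ i == q ⟧ * (⟦ π₁ i == p ⟧ * h i))
      ≡⟨ sum-cong-≗ (λ q → sum-cong-≗ (λ i → x∙yz≈y∙xz ⟦ π₂ i == q ⟧ ⟦ π₁ i == p ⟧ (h i))) ⟩
    ∑[ q < n ] ∑[ i < n * n ] (⟦ π₁ i == p ⟧ * (⟦ π₂ i == q ⟧ * h i)) ≡⟨ sum-cong-≗ (λ q → ∑-cell p q h) ⟩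
    ∑[ q < n ] h (block p q)                                          ∎
    where open ≡-Reasoning

  ∑-part₂ : ∀ q (h : Fin (n * n) → ℕ) → ∑[ i < n * n ] (⟦ π₂ i == q ⟧ * h i) ≡ ∑[ p < n ] h (block p q)
  ∑-part₂ q h = trans (sym (∑-fibres π₁ _)) (sum-cong-≗ (λ p → ∑-cell p q h))

  ∑-blocks : ∀ (h : Fin (n * n) → ℕ) → sum h ≡ ∑[ p < n ] ∑[ q < n ] h (block p q)
  ∑-blocks h = trans (sym (∑-fibres π₁ h)) (sum-cong-≗ (λ p → ∑-part₁ p h))

[m+n%d]%d≡[m+n]%d : ∀ m n d .{{_ : NonZero d}} → (m + n % d) % d ≡ (m + n) % d
[m+n%d]%d≡[m+n]%d m n d = begin
  (m + n % d) % d         ≡⟨ %-distribˡ-+ m (n % d) d ⟩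
  (m % d + n % d % d) % d ≡⟨ cong (λ t → (m % d + t) % d) (m%n%n≡m%n n d) ⟩
  (m % d + n % d) % d     ≡⟨ %-distribˡ-+ m n d ⟨
  (m + n) % d             ∎
  where open ≡-Reasoning

module CyclicGroup (k : ℕ) .{{_ : NonZero k}} where

  infixl 6 _⊕_ _⊖_

  _⊕_ : Fin k → Fin k → Fin k
  u ⊕ v = (toℕ u + toℕ v) mod k

  _⊖_ : Fin k → Fin k → Fin k
  x ⊖ u = (k ∸ toℕ u + toℕ x) mod k

  ⊕-comm : ∀ u v → u ⊕ v ≡ v ⊕ u
  ⊕-comm u v = cong (_mod k) (+-comm (toℕ u) (toℕ v))

  private
    toℕ-mod : ∀ m → toℕ (m mod k) ≡ m % k
    toℕ-mod m = toℕ-fromℕ< (m%n<n m k)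

    shift-cancel : ∀ a b (y : Fin k) → a + b ≡ k → (a + (b + toℕ y) % k) % k ≡ toℕ y
    shift-cancel a b y a+b≡k = begin
      (a + (b + toℕ y) % k) % k  ≡⟨ [m+n%d]%d≡[m+n]%d a (b + toℕ y) k ⟩
      (a + (b + toℕ y)) % k      ≡⟨ cong (_% k) (+-assoc a b (toℕ y)) ⟨
      (a + b + toℕ y) % k        ≡⟨ cong (λ t → (t + toℕ y) % k) a+b≡k ⟩
      (k + toℕ y) % k            ≡⟨ %-remove-+ˡ (toℕ y) ∣-refl ⟩
      toℕ y % k                  ≡⟨ m<n⇒m%n≡m (toℕ<n y) ⟩
      toℕ y                      ∎
      where open ≡-Reasoning

    toℕ-⊕ : ∀ u v → toℕ (u ⊕ v) ≡ (toℕ u + toℕ v) % k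
    toℕ-⊕ u v = toℕ-mod (toℕ u + toℕ v)

  ⊕-⊖ : ∀ u x → u ⊕ (x ⊖ u) ≡ x
  ⊕-⊖ u x = toℕ-injective (trans (toℕ-⊕ u (x ⊖ u)) (trans (cong (λ t → (toℕ u + t) % k) (toℕ-mod _))
                          (shift-cancel (toℕ u) (k ∸ toℕ u) x (m+[n∸m]≡n (<⇒≤ (toℕ<n u))))))

  ⊖-⊕ : ∀ u v → (u ⊕ v) ⊖ u ≡ v
  ⊖-⊕ u v = toℕ-injective (trans (toℕ-mod _) (trans (cong (λ t → (k ∸ toℕ u + t) % k) (toℕ-⊕ u v))
                          (shift-cancel (k ∸ toℕ u) (toℕ u) v (m∸n+n≡m (<⇒≤ (toℕ<n u))))))

  ∑-⊕ʳ : ∀ u x → ∑[ v < k ] ⟦ (u ⊕ v) == x ⟧ ≡ 1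
  ∑-⊕ʳ u x = trans (sum-cong-≗ (λ v → cong ⟦_⟧ (does-⇔ (mk⇔ (λ e → trans (cong (_⊖ u) (sym e)) (⊖-⊕ u v))
                                                             (λ e → trans (cong (u ⊕_) (sym e)) (⊕-⊖ u x)))
                                                      (u ⊕ v ≟ x) (x ⊖ u ≟ v))))
                   (∑-δ₁ (x ⊖ u))

  ∑-⊕ˡ : ∀ v x → ∑[ u < k ] ⟦ (u ⊕ v) == x ⟧ ≡ 1
  ∑-⊕ˡ v x = trans (sum-cong-≗ (λ u → cong (λ y → ⟦ y == x ⟧) (⊕-comm u v))) (∑-⊕ʳ v x)

BoolSquare : ℕ → Set
BoolSquare n = Fin n → Fin n → Bool

↑-elim : ∀ {n m} {P : Fin (n + m) → Set} →
         (∀ p → P (p ↑ˡ m)) → (∀ a → P (n ↑ʳ a)) → ∀ r → P r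
↑-elim {n} {m} {P} top bottom r = subst P (join-splitAt n m r) ([_,_] {C = P ∘ join n m} top bottom (splitAt n r))

module _ {n m : ℕ} (A : BoolSquare n) (D : BoolSquare m) where

  blockDiag : BoolSquare (n + m)
  blockDiag r c = [ (λ p → [ A p , (λ _ → false) ]′ (splitAt n c))
                  , (λ a → [ (λ _ → false) , D a ]′ (splitAt n c)) ]′ (splitAt n r)

  blockDiag-↑ˡ↑ˡ : ∀ p q → blockDiag (p ↑ˡ m) (q ↑ˡ m) ≡ A p q
  blockDiag-↑ˡ↑ˡ p q rewrite splitAt-↑ˡ n p m | splitAt-↑ˡ n q m = refl

  blockDiag-↑ˡ↑ʳ : ∀ p b → blockDiag (p ↑ˡ m) (n ↑ʳ b) ≡ false
  blockDiag-↑ˡ↑ʳ p b rewrite splitAt-↑ˡ n p m | splitAt-↑ʳ n m b = refl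

  blockDiag-↑ʳ↑ˡ : ∀ a q → blockDiag (n ↑ʳ a) (q ↑ˡ m) ≡ false
  blockDiag-↑ʳ↑ˡ a q rewrite splitAt-↑ʳ n m a | splitAt-↑ˡ n q m = refl

  blockDiag-↑ʳ↑ʳ : ∀ a b → blockDiag (n ↑ʳ a) (n ↑ʳ b) ≡ D a b
  blockDiag-↑ʳ↑ʳ a b rewrite splitAt-↑ʳ n m a | splitAt-↑ʳ n m b = refl

  ∑∑-blockDiag : ∀ (h : Fin (n + m) → Fin (n + m) → ℕ) →
    ∑[ r < n + m ] ∑[ c < n + m ] (⟦ blockDiag r c ⟧ * h r c) ≡
      ∑[ p < n ] ∑[ q < n ] (⟦ A p q ⟧ * h (p ↑ˡ m) (q ↑ˡ m)) +
      ∑[ a < m ] ∑[ b < m ] (⟦ D a b ⟧ * h (n ↑ʳ a) (n ↑ʳ b))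
  ∑∑-blockDiag h = begin
    ∑[ r < n + m ] ∑[ c < n + m ] cell r c ≡⟨ ∑∑-↑ n m cell ⟩
    (TL + TR) + (BL + BR)                  ≡⟨ cong₂ _+_ (cong₂ _+_ TL≡ TR≡0) (cong₂ _+_ BL≡0 BR≡) ⟩
    (A-part + 0) + (0 + D-part)            ≡⟨ cong (_+ D-part) (+-identityʳ A-part) ⟩
    A-part + D-part                        ∎
    where
    open ≡-Reasoning
    cell : Fin (n + m) → Fin (n + m) → ℕ
    cell r c = ⟦ blockDiag r c ⟧ * h r c
    TL TR BL BR A-part D-part : ℕ
    TL = ∑[ p < n ] ∑[ q < n ] cell (p ↑ˡ m) (q ↑ˡ m)
    TR = ∑[ p < n ] ∑[ b < m ] cell (p ↑ˡ m) (n ↑ʳ b)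
    BL = ∑[ a < m ] ∑[ q < n ] cell (n ↑ʳ a) (q ↑ˡ m)
    BR = ∑[ a < m ] ∑[ b < m ] cell (n ↑ʳ a) (n ↑ʳ b)
    A-part = ∑[ p < n ] ∑[ q < n ] (⟦ A p q ⟧ * h (p ↑ˡ m) (q ↑ˡ m))
    D-part = ∑[ a < m ] ∑[ b < m ] (⟦ D a b ⟧ * h (n ↑ʳ a) (n ↑ʳ b))
    TL≡ : TL ≡ A-part
    TL≡ = sum-cong-≗ λ p → sum-cong-≗ λ q → cong (λ x → ⟦ x ⟧ * h (p ↑ˡ m) (q ↑ˡ m)) (blockDiag-↑ˡ↑ˡ p q)
    BR≡ : BR ≡ D-part
    BR≡ = sum-cong-≗ λ a → sum-cong-≗ λ b → cong (λ x → ⟦ x ⟧ * h (n ↑ʳ a) (n ↑ʳ b)) (blockDiag-↑ʳ↑ʳ a b)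
    TR≡0 : TR ≡ 0
    TR≡0 = trans (sum-cong-≗ λ p → trans
             (sum-cong-≗ λ b → cong (λ x → ⟦ x ⟧ * h (p ↑ˡ m) (n ↑ʳ b)) (blockDiag-↑ˡ↑ʳ p b))
             (sum-replicate-zero m)) (sum-replicate-zero n)
    BL≡0 : BL ≡ 0
    BL≡0 = trans (sum-cong-≗ λ a → trans
             (sum-cong-≗ λ q → cong (λ x → ⟦ x ⟧ * h (n ↑ʳ a) (q ↑ˡ m)) (blockDiag-↑ʳ↑ˡ a q))
             (sum-replicate-zero n)) (sum-replicate-zero m)

  blockDiag-rows : ∀ {λ₁} → (∀ p → ∑[ q < n ] ⟦ A p q ⟧ ≡ λ₁) → (∀ a → ∑[ b < m ] ⟦ D a b ⟧ ≡ λ₁) →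
                   ∀ r → ∑[ c < n + m ] ⟦ blockDiag r c ⟧ ≡ λ₁
  blockDiag-rows {λ₁} rowA rowD = ↑-elim top bottom
    where
    top : ∀ p → ∑[ c < n + m ] ⟦ blockDiag (p ↑ˡ m) c ⟧ ≡ λ₁
    top p = begin
      ∑[ c < n + m ] ⟦ blockDiag (p ↑ˡ m) c ⟧                                             ≡⟨ ∑-↑ n _ ⟩
      ∑[ q < n ] ⟦ blockDiag (p ↑ˡ m) (q ↑ˡ m) ⟧ + ∑[ b < m ] ⟦ blockDiag (p ↑ˡ m) (n ↑ʳ b) ⟧
        ≡⟨ cong₂ _+_ (sum-cong-≗ (cong ⟦_⟧ ∘ blockDiag-↑ˡ↑ˡ p))
                     (trans (sum-cong-≗ (cong ⟦_⟧ ∘ blockDiag-↑ˡ↑ʳ p)) (sum-replicate-zero m)) ⟩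
      ∑[ q < n ] ⟦ A p q ⟧ + 0                                                            ≡⟨ +-identityʳ _ ⟩
      ∑[ q < n ] ⟦ A p q ⟧                                                                ≡⟨ rowA p ⟩
      λ₁                                                                                  ∎
      where open ≡-Reasoning
    bottom : ∀ a → ∑[ c < n + m ] ⟦ blockDiag (n ↑ʳ a) c ⟧ ≡ λ₁
    bottom a = begin
      ∑[ c < n + m ] ⟦ blockDiag (n ↑ʳ a) c ⟧                                             ≡⟨ ∑-↑ n _ ⟩
      ∑[ q < n ] ⟦ blockDiag (n ↑ʳ a) (q ↑ˡ m) ⟧ + ∑[ b < m ] ⟦ blockDiag (n ↑ʳ a) (n ↑ʳ b) ⟧
        ≡⟨ cong₂ _+_ (trans (sum-cong-≗ (cong ⟦_⟧ ∘ blockDiag-↑ʳ↑ˡ a)) (sum-replicate-zero n))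
                     (sum-cong-≗ (cong ⟦_⟧ ∘ blockDiag-↑ʳ↑ʳ a)) ⟩
      0 + ∑[ b < m ] ⟦ D a b ⟧                                                            ≡⟨ rowD a ⟩
      λ₁                                                                                  ∎
      where open ≡-Reasoning

blockDiag-transpose : ∀ {n m} (A : BoolSquare n) (D : BoolSquare m) r c →
                      blockDiag A D r c ≡ blockDiag (flip A) (flip D) c r
blockDiag-transpose {n} A D r c with splitAt n r | splitAt n c
... | inj₁ p | inj₁ q = refl
... | inj₁ p | inj₂ b = refl
... | inj₂ a | inj₁ q = refl
... | inj₂ a | inj₂ b = refl

blockDiag-cols : ∀ {n m λ₁} (A : BoolSquare n) (D : BoolSquare m) →
                 (∀ q → ∑[ p < n ] ⟦ A p q ⟧ ≡ λ₁) → (∀ b → ∑[ a < m ] ⟦ D a b ⟧ ≡ λ₁) →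
                 ∀ c → ∑[ r < n + m ] ⟦ blockDiag A D r c ⟧ ≡ λ₁
blockDiag-cols A D colA colD c =
  trans (sum-cong-≗ (λ r → cong ⟦_⟧ (blockDiag-transpose A D r c))) (blockDiag-rows (flip A) (flip D) colA colD c)

toFin2 : Bool → Fin 2
toFin2 false = zero
toFin2 true  = suc zero

toFin2==1 : ∀ b → (toFin2 b == suc zero) ≡ b
toFin2==1 false = refl
toFin2==1 true  = refl

⟦toFin2==0⟧+⟦toFin2==1⟧ : ∀ b → ⟦ toFin2 b == zero ⟧ + ⟦ toFin2 b == suc zero ⟧ ≡ 1
⟦toFin2==0⟧+⟦toFin2==1⟧ false = refl
⟦toFin2==0⟧+⟦toFin2==1⟧ true  = refl

module BinarySquares {N M λ₁ : ℕ} (N≡M+λ₁ : N ≡ M + λ₁) where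

  μ : Fin 2 → ℕ
  μ = binType M λ₁

  toFin2-count : (e : Fin N → Bool) → ∑[ c < N ] ⟦ e c ⟧ ≡ λ₁ →
                 ∀ i → ∑[ c < N ] ⟦ toFin2 (e c) == i ⟧ ≡ μ i
  toFin2-count e ones (suc zero) = trans (sum-cong-≗ (cong ⟦_⟧ ∘ toFin2==1 ∘ e)) ones
  toFin2-count e ones zero = +-cancelʳ-≡ λ₁ _ _ (begin
    sum zeros + λ₁                   ≡⟨ cong (sum zeros +_) (toFin2-count e ones (suc zero)) ⟨
    sum zeros + sum nonzeros         ≡⟨ ∑-distrib-+ zeros nonzeros ⟨
    ∑[ c < N ] (zeros c + nonzeros c) ≡⟨ sum-cong-≗ (⟦toFin2==0⟧+⟦toFin2==1⟧ ∘ e) ⟩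
    ∑[ c < N ] 1                     ≡⟨ ∑-const N 1 ⟩
    N * 1                            ≡⟨ *-identityʳ N ⟩
    N                                ≡⟨ N≡M+λ₁ ⟩
    M + λ₁                           ∎)
    where
    open ≡-Reasoning
    zeros nonzeros : Fin N → ℕ
    zeros c = ⟦ toFin2 (e c) == zero ⟧
    nonzeros c = ⟦ toFin2 (e c) == suc zero ⟧

  toFin2-isFreqSquare : 1 ≤ M → 1 ≤ λ₁ → (e : BoolSquare N) →
    (∀ r → ∑[ c < N ] ⟦ e r c ⟧ ≡ λ₁) → (∀ c → ∑[ r < N ] ⟦ e r c ⟧ ≡ λ₁) →
    IsFreqSquare N 2 μ (λ r c → toFin2 (e r c))
  toFin2-isFreqSquare 1≤M 1≤λ₁ e rows cols = record
    { atLeastTwo = s≤s (s≤s z≤n)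
    ; positive   = λ { zero → 1≤M ; (suc zero) → 1≤λ₁ }
    ; rows       = λ r i → trans (count≡∑ (λ c → toFin2 (e r c) == i))
                                 (toFin2-count (e r) (rows r) i)
    ; cols       = λ c i → trans (count≡∑ (λ r → toFin2 (e r c) == i))
                                 (toFin2-count (λ r → e r c) (cols c) i)
    }

  toFin2-orthogonal : (e₁ e₂ : BoolSquare N) →
    (∀ r → ∑[ c < N ] ⟦ e₁ r c ⟧ ≡ λ₁) → (∀ r → ∑[ c < N ] ⟦ e₂ r c ⟧ ≡ λ₁) →
    ∑[ r < N ] ∑[ c < N ] (⟦ e₁ r c ⟧ * ⟦ e₂ r c ⟧) ≡ λ₁ * λ₁ →
    OrthogonalSq μ μ (λ r c → toFin2 (e₁ r c)) (λ r c → toFin2 (e₂ r c))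
  toFin2-orthogonal e₁ e₂ rows₁ rows₂ ones∩ones i j =
    trans (countCells≡∑∑ (λ r c → (t₁ r c == i) ∧ (t₂ r c == j)))
          (trans (sum-cong-≗ λ r → sum-cong-≗ λ c → ⟦∧⟧ (t₁ r c == i) (t₂ r c == j)) (X≡ i j))
    where
    t₁ t₂ : Fin N → Fin N → Fin 2
    t₁ r c = toFin2 (e₁ r c)
    t₂ r c = toFin2 (e₂ r c)

    X : Fin 2 → Fin 2 → ℕ
    X i j = ∑[ r < N ] ∑[ c < N ] (⟦ t₁ r c == i ⟧ * ⟦ t₂ r c == j ⟧)

    ones : ∀ (t : Fin N → Fin N → Fin 2) → (∀ r i → ∑[ c < N ] ⟦ t r c == i ⟧ ≡ μ i) →
           ∀ i → ∑[ r < N ] ∑[ c < N ] ⟦ t r c == i ⟧ ≡ (M + λ₁) * μ i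
    ones t rows i = trans (sum-cong-≗ λ r → rows r i) (trans (∑-const N (μ i)) (cong (_* μ i) N≡M+λ₁))

    split₁ : ∀ j → X zero j + X (suc zero) j ≡ ∑[ r < N ] ∑[ c < N ] ⟦ t₂ r c == j ⟧
    split₁ j = trans (sym (∑∑-distrib-+ (λ r c → ⟦ t₁ r c == zero ⟧ * ⟦ t₂ r c == j ⟧)
                                        (λ r c → ⟦ t₁ r c == suc zero ⟧ * ⟦ t₂ r c == j ⟧)))
                     (sum-cong-≗ λ r → sum-cong-≗ λ c →
      trans (sym (*-distribʳ-+ ⟦ t₂ r c == j ⟧ ⟦ t₁ r c == zero ⟧ ⟦ t₁ r c == suc zero ⟧))
            (trans (cong (_* ⟦ t₂ r c == j ⟧) (⟦toFin2==0⟧+⟦toFin2==1⟧ (e₁ r c))) (*-identityˡ _)))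

    split₂ : ∀ i → X i zero + X i (suc zero) ≡ ∑[ r < N ] ∑[ c < N ] ⟦ t₁ r c == i ⟧
    split₂ i = trans (sym (∑∑-distrib-+ (λ r c → ⟦ t₁ r c == i ⟧ * ⟦ t₂ r c == zero ⟧)
                                        (λ r c → ⟦ t₁ r c == i ⟧ * ⟦ t₂ r c == suc zero ⟧)))
                     (sum-cong-≗ λ r → sum-cong-≗ λ c →
      trans (sym (*-distribˡ-+ ⟦ t₁ r c == i ⟧ ⟦ t₂ r c == zero ⟧ ⟦ t₂ r c == suc zero ⟧))
            (trans (cong (⟦ t₁ r c == i ⟧ *_) (⟦toFin2==0⟧+⟦toFin2==1⟧ (e₂ r c))) (*-identityʳ _)))

    X₁₁ : X (suc zero) (suc zero) ≡ λ₁ * λ₁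
    X₁₁ = trans (sum-cong-≗ λ r → sum-cong-≗ λ c →
                   cong₂ (λ a b → ⟦ a ⟧ * ⟦ b ⟧) (toFin2==1 (e₁ r c)) (toFin2==1 (e₂ r c)))
                ones∩ones

    X₀₁ : X zero (suc zero) ≡ M * λ₁
    X₀₁ = +-cancelʳ-≡ (λ₁ * λ₁) _ _ (begin
      X zero (suc zero) + λ₁ * λ₁                         ≡⟨ cong (X zero (suc zero) +_) X₁₁ ⟨
      X zero (suc zero) + X (suc zero) (suc zero)         ≡⟨ split₁ (suc zero) ⟩
      ∑[ r < N ] ∑[ c < N ] ⟦ t₂ r c == suc zero ⟧
        ≡⟨ ones t₂ (λ r → toFin2-count (e₂ r) (rows₂ r)) (suc zero) ⟩
      (M + λ₁) * λ₁                                       ≡⟨ *-distribʳ-+ λ₁ M λ₁ ⟩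
      M * λ₁ + λ₁ * λ₁                                    ∎)
      where open ≡-Reasoning

    X·₁ : ∀ i → X i (suc zero) ≡ μ i * λ₁
    X·₁ zero       = X₀₁
    X·₁ (suc zero) = X₁₁

    X·₀ : ∀ i → X i zero ≡ μ i * M
    X·₀ i = +-cancelʳ-≡ (μ i * λ₁) _ _ (begin
      X i zero + μ i * λ₁                                 ≡⟨ cong (X i zero +_) (X·₁ i) ⟨
      X i zero + X i (suc zero)                           ≡⟨ split₂ i ⟩
      ∑[ r < N ] ∑[ c < N ] ⟦ t₁ r c == i ⟧               ≡⟨ ones t₁ (λ r → toFin2-count (e₁ r) (rows₁ r)) i ⟩
      (M + λ₁) * μ i                                      ≡⟨ *-comm (M + λ₁) (μ i) ⟩
      μ i * (M + λ₁)                                      ≡⟨ *-distribˡ-+ (μ i) M λ₁ ⟩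
      μ i * M + μ i * λ₁                                  ∎)
      where open ≡-Reasoning

    X≡ : ∀ i j → X i j ≡ μ i * μ j
    X≡ i zero       = X·₀ i
    X≡ i (suc zero) = X·₁ i

  ones-orthogonal : (G : Square N 2) (e : BoolSquare N) → OrthogonalSq μ μ G (λ r c → toFin2 (e r c)) →
    ∑[ r < N ] ∑[ c < N ] (⟦ e r c ⟧ * ⟦ G r c == suc zero ⟧) ≡ λ₁ * λ₁
  ones-orthogonal G e G⊥e = begin
    ∑[ r < N ] ∑[ c < N ] (⟦ e r c ⟧ * ⟦ G r c == suc zero ⟧)
      ≡⟨ sum-cong-≗ (λ r → sum-cong-≗ (λ c → *-comm ⟦ e r c ⟧ ⟦ G r c == suc zero ⟧)) ⟩
    ∑[ r < N ] ∑[ c < N ] (⟦ G r c == suc zero ⟧ * ⟦ e r c ⟧)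
      ≡⟨ sum-cong-≗ (λ r → sum-cong-≗ (λ c → cong (λ b → ⟦ G r c == suc zero ⟧ * ⟦ b ⟧) (toFin2==1 (e r c)))) ⟨
    ∑[ r < N ] ∑[ c < N ] (⟦ G r c == suc zero ⟧ * ⟦ toFin2 (e r c) == suc zero ⟧)
      ≡⟨ sum-cong-≗ (λ r → sum-cong-≗ (λ c → ⟦∧⟧ (G r c == suc zero) (toFin2 (e r c) == suc zero))) ⟨
    ∑[ r < N ] ∑[ c < N ] ⟦ (G r c == suc zero) ∧ (toFin2 (e r c) == suc zero) ⟧
      ≡⟨ countCells≡∑∑ (λ r c → (G r c == suc zero) ∧ (toFin2 (e r c) == suc zero)) ⟨
    countCells (λ r c → (G r c == suc zero) ∧ (toFin2 (e r c) == suc zero))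
      ≡⟨ G⊥e (suc zero) (suc zero) ⟩
    λ₁ * λ₁ ∎
    where open ≡-Reasoning

module OrthogonalToBlockDiagonals {n m k λ₁ : ℕ} (m≡kλ₁ : m ≡ k * λ₁)
  (A : Fin k → BoolSquare n) (D : Fin k → BoolSquare m) (D-partition : ∀ a b → ∑[ s < k ] ⟦ D s a b ⟧ ≡ 1)
  (g : Fin (n + m) → Fin (n + m) → ℕ)
  (rows : ∀ r → ∑[ c < n + m ] g r c ≡ λ₁) (cols : ∀ c → ∑[ r < n + m ] g r c ≡ λ₁)
  (orth : ∀ s → ∑[ r < n + m ] ∑[ c < n + m ] (⟦ blockDiag (A s) (D s) r c ⟧ * g r c) ≡ λ₁ * λ₁) where

  multiplicity : Fin n → Fin n → ℕ
  multiplicity p q = ∑[ s < k ] ⟦ A s p q ⟧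

  private
    gTL : Fin n → Fin n → ℕ
    gTL p q = g (p ↑ˡ m) (q ↑ˡ m)

    gBR : Fin m → Fin m → ℕ
    gBR a b = g (n ↑ʳ a) (n ↑ʳ b)

    TL BL BR Weighted : ℕ
    TL = ∑[ p < n ] ∑[ q < n ] gTL p q
    BL = ∑[ a < m ] ∑[ q < n ] g (n ↑ʳ a) (q ↑ˡ m)
    BR = ∑[ a < m ] ∑[ b < m ] gBR a b
    Weighted = ∑[ p < n ] ∑[ q < n ] (multiplicity p q * gTL p q)

    weighted+BR : k * (λ₁ * λ₁) ≡ Weighted + BR
    weighted+BR = begin
      k * (λ₁ * λ₁)                                                          ≡⟨ ∑-const k (λ₁ * λ₁) ⟨
      ∑[ s < k ] (λ₁ * λ₁)                                                   ≡⟨ sum-cong-≗ orth ⟨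
      ∑[ s < k ] ∑[ r < n + m ] ∑[ c < n + m ] (⟦ blockDiag (A s) (D s) r c ⟧ * g r c)
        ≡⟨ sum-cong-≗ (λ s → ∑∑-blockDiag (A s) (D s) g) ⟩
      ∑[ s < k ] (TLₛ s + BRₛ s)                                             ≡⟨ ∑-distrib-+ TLₛ BRₛ ⟩
      ∑[ s < k ] TLₛ s + ∑[ s < k ] BRₛ s
        ≡⟨ cong₂ _+_ (∑-pull-weight (λ s p q → ⟦ A s p q ⟧) gTL) (∑-pull-weight (λ s a b → ⟦ D s a b ⟧) gBR) ⟩
      Weighted + ∑[ a < m ] ∑[ b < m ] (∑[ s < k ] ⟦ D s a b ⟧ * gBR a b)
        ≡⟨ cong (Weighted +_) (sum-cong-≗ λ a → sum-cong-≗ λ b →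
             trans (cong (_* gBR a b) (D-partition a b)) (*-identityˡ (gBR a b))) ⟩
      Weighted + BR                                                          ∎
      where
      open ≡-Reasoning
      TLₛ BRₛ : Fin k → ℕ
      TLₛ s = ∑[ p < n ] ∑[ q < n ] (⟦ A s p q ⟧ * gTL p q)
      BRₛ s = ∑[ a < m ] ∑[ b < m ] (⟦ D s a b ⟧ * gBR a b)

    bottomRows : BL + BR ≡ m * λ₁
    bottomRows = begin
      BL + BR
        ≡⟨ ∑-distrib-+ (λ a → ∑[ q < n ] g (n ↑ʳ a) (q ↑ˡ m)) (λ a → ∑[ b < m ] gBR a b) ⟨
      ∑[ a < m ] (∑[ q < n ] g (n ↑ʳ a) (q ↑ˡ m) + ∑[ b < m ] gBR a b)
        ≡⟨ sum-cong-≗ (λ a → ∑-↑ n (g (n ↑ʳ a))) ⟨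
      ∑[ a < m ] ∑[ c < n + m ] g (n ↑ʳ a) c                                ≡⟨ sum-cong-≗ (rows ∘ (n ↑ʳ_)) ⟩
      ∑[ a < m ] λ₁                                                         ≡⟨ ∑-const m λ₁ ⟩
      m * λ₁                                                                ∎
      where open ≡-Reasoning

    leftColumns : TL + BL ≡ n * λ₁
    leftColumns = begin
      TL + BL
        ≡⟨ cong₂ _+_ (∑-comm gTL) (∑-comm (λ a q → g (n ↑ʳ a) (q ↑ˡ m))) ⟩
      ∑[ q < n ] ∑[ p < n ] gTL p q + ∑[ q < n ] ∑[ a < m ] g (n ↑ʳ a) (q ↑ˡ m)
        ≡⟨ ∑-distrib-+ (λ q → ∑[ p < n ] gTL p q) (λ q → ∑[ a < m ] g (n ↑ʳ a) (q ↑ˡ m)) ⟨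
      ∑[ q < n ] (∑[ p < n ] gTL p q + ∑[ a < m ] g (n ↑ʳ a) (q ↑ˡ m))
        ≡⟨ sum-cong-≗ (λ q → ∑-↑ n (λ r → g r (q ↑ˡ m))) ⟨
      ∑[ q < n ] ∑[ r < n + m ] g r (q ↑ˡ m)                                ≡⟨ sum-cong-≗ (cols ∘ (_↑ˡ m)) ⟩
      ∑[ q < n ] λ₁                                                         ≡⟨ ∑-const n λ₁ ⟩
      n * λ₁                                                                ∎
      where open ≡-Reasoning

    Weighted≡BL : Weighted ≡ BL
    Weighted≡BL = +-cancelʳ-≡ BR Weighted BL (begin
      Weighted + BR      ≡⟨ weighted+BR ⟨
      k * (λ₁ * λ₁)      ≡⟨ *-assoc k λ₁ λ₁ ⟨
      k * λ₁ * λ₁        ≡⟨ cong (_* λ₁) m≡kλ₁ ⟨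
      m * λ₁             ≡⟨ bottomRows ⟨
      BL + BR            ∎)
      where open ≡-Reasoning

  ∑-weighted-topLeft : ∑[ p < n ] ∑[ q < n ] (suc (multiplicity p q) * g (p ↑ˡ m) (q ↑ˡ m)) ≡ n * λ₁
  ∑-weighted-topLeft = begin
    ∑[ p < n ] ∑[ q < n ] (gTL p q + multiplicity p q * gTL p q)
      ≡⟨ ∑∑-distrib-+ gTL (λ p q → multiplicity p q * gTL p q) ⟩
    TL + Weighted  ≡⟨ cong (TL +_) Weighted≡BL ⟩
    TL + BL        ≡⟨ leftColumns ⟩
    n * λ₁         ∎
    where open ≡-Reasoning

∣∣≡∑ : ∀ {k} (S : Subset k) → ∣ S ∣ ≡ ∑[ x < k ] ⟦ x ∈B S ⟧
∣∣≡∑ []          = refl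
∣∣≡∑ (true ∷ S)  = cong suc (∣∣≡∑ S)
∣∣≡∑ (false ∷ S) = ∣∣≡∑ S

∑-blockSizes : ∀ {k b R} (B : Blocks k b) → (∀ x → count (λ i → x ∈B B i) ≡ R) →
               ∑[ i < b ] ∣ B i ∣ ≡ k * R
∑-blockSizes {k} {b} {R} B replication = begin
  ∑[ i < b ] ∣ B i ∣                  ≡⟨ sum-cong-≗ (∣∣≡∑ ∘ B) ⟩
  ∑[ i < b ] ∑[ x < k ] ⟦ x ∈B B i ⟧  ≡⟨ ∑-comm (λ i x → ⟦ x ∈B B i ⟧) ⟩
  ∑[ x < k ] ∑[ i < b ] ⟦ x ∈B B i ⟧  ≡⟨ sum-cong-≗ (λ x → count≡∑ (λ i → x ∈B B i)) ⟨
  ∑[ x < k ] count (λ i → x ∈B B i)  ≡⟨ sum-cong-≗ replication ⟩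
  ∑[ x < k ] R                        ≡⟨ ∑-const k R ⟩
  k * R                               ∎
  where open ≡-Reasoning

ModEq-pred⇒∣suc : ∀ w x → ModEq (suc w) x w → suc w ∣ suc x
ModEq-pred⇒∣suc w x x≡w = divides (suc (x / suc w)) (cong suc (begin
  x                              ≡⟨ m≡m%n+[m/n]*n x (suc w) ⟩
  x % suc w + x / suc w * suc w  ≡⟨ cong (_+ x / suc w * suc w) (trans x≡w (m<n⇒m%n≡m (n<1+n w))) ⟩
  w + x / suc w * suc w          ∎))
  where open ≡-Reasoning

module Construction {λ₁ n k : ℕ} .{{_ : NonZero k}}
  (B : Blocks k (n * n)) (dk : IsDK (λ₁ * n) (λ₁ * λ₁) B)
  (π₁ π₂ : Fin (n * n) → Fin n) (type₁ : IsTypeNN π₁) (orth : OrthogonalPartitions π₁ π₂)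
  (equi₁ : IsEquipartitionWith λ₁ B π₁) (equi₂ : IsEquipartitionWith λ₁ B π₂) where

  open OrthogonalGrid π₁ π₂ type₁ orth
  open CyclicGroup k

  topLeft : Fin k → BoolSquare n
  topLeft x p q = x ∈B B (block p q)

  -- The cyclic Latin square of order k with every cell inflated to a λ₁ × λ₁ block.
  bottomRight : Fin k → BoolSquare (k * λ₁)
  bottomRight x a b = (quotient λ₁ a ⊕ quotient λ₁ b) == x

  incidence : Fin k → BoolSquare (n + k * λ₁)
  incidence x = blockDiag (topLeft x) (bottomRight x)

  private
    equipartition⇒∑ : ∀ (π : Fin (n * n) → Fin n) → IsEquipartitionWith λ₁ B π →
                      ∀ p x → ∑[ i < n * n ] (⟦ π i == p ⟧ * ⟦ x ∈B B i ⟧) ≡ λ₁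
    equipartition⇒∑ π equi p x = begin
      ∑[ i < n * n ] (⟦ π i == p ⟧ * ⟦ x ∈B B i ⟧)  ≡⟨ sum-cong-≗ (λ i → ⟦∧⟧ (π i == p) (x ∈B B i)) ⟨
      ∑[ i < n * n ] ⟦ (π i == p) ∧ (x ∈B B i) ⟧    ≡⟨ count≡∑ (λ i → (π i == p) ∧ (x ∈B B i)) ⟨
      count (λ i → (π i == p) ∧ (x ∈B B i))         ≡⟨ equi p x ⟩
      λ₁                                            ∎
      where open ≡-Reasoning

    bottomRight-rows : ∀ x a → ∑[ b < k * λ₁ ] ⟦ bottomRight x a b ⟧ ≡ λ₁
    bottomRight-rows x a = begin
      ∑[ b < k * λ₁ ] ⟦ bottomRight x a b ⟧          ≡⟨ ∑-quotient k λ₁ (λ v → ⟦ (quotient λ₁ a ⊕ v) == x ⟧) ⟩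
      λ₁ * ∑[ v < k ] ⟦ (quotient λ₁ a ⊕ v) == x ⟧   ≡⟨ cong (λ₁ *_) (∑-⊕ʳ (quotient λ₁ a) x) ⟩
      λ₁ * 1                                        ≡⟨ *-identityʳ λ₁ ⟩
      λ₁                                            ∎
      where open ≡-Reasoning

    bottomRight-cols : ∀ x b → ∑[ a < k * λ₁ ] ⟦ bottomRight x a b ⟧ ≡ λ₁
    bottomRight-cols x b = begin
      ∑[ a < k * λ₁ ] ⟦ bottomRight x a b ⟧          ≡⟨ ∑-quotient k λ₁ (λ u → ⟦ (u ⊕ quotient λ₁ b) == x ⟧) ⟩
      λ₁ * ∑[ u < k ] ⟦ (u ⊕ quotient λ₁ b) == x ⟧   ≡⟨ cong (λ₁ *_) (∑-⊕ˡ (quotient λ₁ b) x) ⟩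
      λ₁ * 1                                        ≡⟨ *-identityʳ λ₁ ⟩
      λ₁                                            ∎
      where open ≡-Reasoning

  incidence-rows : ∀ x r → ∑[ c < n + k * λ₁ ] ⟦ incidence x r c ⟧ ≡ λ₁
  incidence-rows x = blockDiag-rows (topLeft x) (bottomRight x)
    (λ p → trans (sym (∑-part₁ p (λ i → ⟦ x ∈B B i ⟧))) (equipartition⇒∑ π₁ equi₁ p x))
    (bottomRight-rows x)

  incidence-cols : ∀ x c → ∑[ r < n + k * λ₁ ] ⟦ incidence x r c ⟧ ≡ λ₁
  incidence-cols x = blockDiag-cols (topLeft x) (bottomRight x)
    (λ q → trans (sym (∑-part₂ q (λ i → ⟦ x ∈B B i ⟧))) (equipartition⇒∑ π₂ equi₂ q x))
    (bottomRight-cols x)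

  incidence-orthogonal : ∀ s t → s ≢ t →
    ∑[ r < n + k * λ₁ ] ∑[ c < n + k * λ₁ ] (⟦ incidence s r c ⟧ * ⟦ incidence t r c ⟧) ≡ λ₁ * λ₁
  incidence-orthogonal s t s≢t = begin
    ∑[ r < n + k * λ₁ ] ∑[ c < n + k * λ₁ ] (⟦ incidence s r c ⟧ * ⟦ incidence t r c ⟧)
      ≡⟨ ∑∑-blockDiag (topLeft s) (bottomRight s) (λ r c → ⟦ incidence t r c ⟧) ⟩
    ∑[ p < n ] ∑[ q < n ] (⟦ topLeft s p q ⟧ * ⟦ incidence t (p ↑ˡ m) (q ↑ˡ m) ⟧) +
    ∑[ a < m ] ∑[ b < m ] (⟦ bottomRight s a b ⟧ * ⟦ incidence t (n ↑ʳ a) (n ↑ʳ b) ⟧)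
      ≡⟨ cong₂ _+_ (sum-cong-≗ λ p → sum-cong-≗ λ q →
                      cong (λ y → ⟦ topLeft s p q ⟧ * ⟦ y ⟧) (blockDiag-↑ˡ↑ˡ (topLeft t) (bottomRight t) p q))
                   (trans (sum-cong-≗ λ a → trans (sum-cong-≗ λ b → trans
                      (cong (λ y → ⟦ bottomRight s a b ⟧ * ⟦ y ⟧) (blockDiag-↑ʳ↑ʳ (topLeft t) (bottomRight t) a b))
                      (==-disjoint (quotient λ₁ a ⊕ quotient λ₁ b) s≢t)) (sum-replicate-zero m))
                          (sum-replicate-zero m)) ⟩
    ∑[ p < n ] ∑[ q < n ] (⟦ s ∈B B (block p q) ⟧ * ⟦ t ∈B B (block p q) ⟧) + 0
      ≡⟨ +-identityʳ _ ⟩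
    ∑[ p < n ] ∑[ q < n ] (⟦ s ∈B B (block p q) ⟧ * ⟦ t ∈B B (block p q) ⟧)
      ≡⟨ ∑-blocks (λ i → ⟦ s ∈B B i ⟧ * ⟦ t ∈B B i ⟧) ⟨
    ∑[ i < n * n ] (⟦ s ∈B B i ⟧ * ⟦ t ∈B B i ⟧)
      ≡⟨ sum-cong-≗ (λ i → ⟦∧⟧ (s ∈B B i) (t ∈B B i)) ⟨
    ∑[ i < n * n ] ⟦ (s ∈B B i) ∧ (t ∈B B i) ⟧
      ≡⟨ count≡∑ (λ i → (s ∈B B i) ∧ (t ∈B B i)) ⟨
    count (λ i → (s ∈B B i) ∧ (t ∈B B i))
      ≡⟨ IsDK.pairs dk s t s≢t ⟩
    λ₁ * λ₁ ∎
    where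
    open ≡-Reasoning
    m = k * λ₁

  bottomRight-partition : ∀ a b → ∑[ s < k ] ⟦ bottomRight s a b ⟧ ≡ 1
  bottomRight-partition a b = ∑-δ₁ (quotient λ₁ a ⊕ quotient λ₁ b)

  blockSizes⇒∣ : ∀ w → (∀ i → ModEq (suc w) ∣ B i ∣ w) → suc w ∣ n * (n + k * λ₁)
  blockSizes⇒∣ w sizes =
    subst (suc w ∣_) ∑-suc-sizes (∑-∣ (λ i → suc ∣ B i ∣) (λ i → ModEq-pred⇒∣suc w _ (sizes i)))
    where
    ∑-suc-sizes : ∑[ i < n * n ] suc ∣ B i ∣ ≡ n * (n + k * λ₁)
    ∑-suc-sizes = begin
      ∑[ i < n * n ] (1 + ∣ B i ∣)           ≡⟨ ∑-distrib-+ (λ _ → 1) (λ i → ∣ B i ∣) ⟩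
      ∑[ i < n * n ] 1 + ∑[ i < n * n ] ∣ B i ∣
        ≡⟨ cong₂ _+_ (∑-const (n * n) 1) (∑-blockSizes B (IsDK.replication dk)) ⟩
      n * n * 1 + k * (λ₁ * n)               ≡⟨ identity n k λ₁ ⟩
      n * (n + k * λ₁)                       ∎
      where
      open ≡-Reasoning
      identity : ∀ n k λ₁ → n * n * 1 + k * (λ₁ * n) ≡ n * (n + k * λ₁)
      identity = solve-∀

  module _ {M} (N≡M+λ₁ : n + k * λ₁ ≡ M + λ₁) where
    open BinarySquares {M = M} {λ₁ = λ₁} N≡M+λ₁

    squares : Fin k → Square (n + k * λ₁) 2
    squares x r c = toFin2 (incidence x r c)

    squares-MOBFS : 1 ≤ M → 1 ≤ λ₁ → IsMOBFS k (n + k * λ₁) (λ _ → μ) squares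
    squares-MOBFS 1≤M 1≤λ₁ = record
      { freq = λ x → toFin2-isFreqSquare 1≤M 1≤λ₁ (incidence x) (incidence-rows x) (incidence-cols x)
      ; orth = λ s t s≢t → toFin2-orthogonal (incidence s) (incidence t) (incidence-rows s) (incidence-rows t)
                                             (incidence-orthogonal s t s≢t)
      }

    orthogonal-square⇒∣ : ∀ w → (∀ i → ModEq (suc w) ∣ B i ∣ w) →
      (G : Square (n + k * λ₁) 2) → IsFreqSquare (n + k * λ₁) 2 μ G → (∀ s → OrthogonalSq μ μ G (squares s)) →
      suc w ∣ n * λ₁
    orthogonal-square⇒∣ w sizes G G-freq G⊥squares =
      subst (suc w ∣_) ∑-weighted-topLeft (∑-∣ _ λ p → ∑-∣ _ λ q → ∣m⇒∣m*n _ (∣suc-multiplicity p q))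
      where
      ones : Fin (n + k * λ₁) → Fin (n + k * λ₁) → ℕ
      ones r c = ⟦ G r c == suc zero ⟧
      open OrthogonalToBlockDiagonals refl topLeft bottomRight bottomRight-partition ones
        (λ r → trans (sym (count≡∑ (λ c → G r c == suc zero))) (IsFreqSquare.rows G-freq r (suc zero)))
        (λ c → trans (sym (count≡∑ (λ r → G r c == suc zero))) (IsFreqSquare.cols G-freq c (suc zero)))
        (λ s → ones-orthogonal G (incidence s) (G⊥squares s))

      ∣suc-multiplicity : ∀ p q → suc w ∣ suc (multiplicity p q)
      ∣suc-multiplicity p q =
        subst (λ x → suc w ∣ suc x) (∣∣≡∑ (B (block p q))) (ModEq-pred⇒∣suc w _ (sizes (block p q)))

∣-coprime-cancel : ∀ {d a b c} → Coprime a d ⊎ Coprime b d → d ∣ c * a → d ∣ c * (b + a) → d ∣ c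
∣-coprime-cancel {d} {a} {b} {c} (inj₁ a⊥d) d∣ca _ =
  coprime-divisor (⊥-sym a⊥d) (subst (d ∣_) (*-comm c a) d∣ca)
∣-coprime-cancel {d} {a} {b} {c} (inj₂ b⊥d) d∣ca d∣c[b+a] =
  coprime-divisor (⊥-sym b⊥d) (subst (d ∣_) (*-comm c b) d∣cb)
  where
  d∣cb : d ∣ c * b
  d∣cb = ∣m+n∣m⇒∣n (subst (d ∣_) (trans (cong (c *_) (+-comm b a)) (*-distribˡ-+ c a b)) d∣c[b+a]) d∣ca

lemma4p2 : (λ₁ n k : ℕ) → 1 ≤ λ₁ → 1 ≤ n → 1 ≤ k →
    (B : Blocks k (n * n)) → IsDK (λ₁ * n) (λ₁ * λ₁) B →
    (π₁ π₂ : Fin (n * n) → Fin n) →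
    IsTypeNN π₁ → IsTypeNN π₂ →
    IsEquipartitionWith λ₁ B π₁ → IsEquipartitionWith λ₁ B π₂ →
    OrthogonalPartitions π₁ π₂ →
    (w : ℕ) → 1 ≤ w →
    (∀ (i : Fin (n * n)) → ModEq w ∣ B i ∣ (w ∸ 1)) →
    (Coprime λ₁ w ⊎ Coprime (n + (k ∸ 1) * λ₁) w) →
    ¬ ModEq w n 0 →
    Σ (Fin k → Square (n + k * λ₁) 2) λ F →
      IsMOBFS k (n + k * λ₁) (λ _ → binType (n + (k ∸ 1) * λ₁) λ₁) F ×
      TypeMaximal (λ _ → binType (n + (k ∸ 1) * λ₁) λ₁) F
lemma4p2 λ₁ n (suc k) 1≤λ₁ 1≤n _ B dk π₁ π₂ type₁ _ equi₁ equi₂ orth (suc w) _ sizes coprime w∤n =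
  squares N≡M+λ₁ , squares-MOBFS N≡M+λ₁ (≤-trans 1≤n (m≤m+n n (k * λ₁))) 1≤λ₁ , typeMaximal
  where
  open Construction B dk π₁ π₂ type₁ orth equi₁ equi₂

  M : ℕ
  M = n + k * λ₁

  N≡M+λ₁ : n + suc k * λ₁ ≡ M + λ₁
  N≡M+λ₁ = trans (cong (n +_) (+-comm λ₁ (k * λ₁))) (sym (+-assoc n (k * λ₁) λ₁))

  typeMaximal : TypeMaximal (λ _ → binType M λ₁) (squares N≡M+λ₁)
  typeMaximal (G , _ , G-freq , G⊥squares) = w∤n (n∣m⇒m%n≡0 n (suc w) (∣-coprime-cancel coprime
    (orthogonal-square⇒∣ N≡M+λ₁ w sizes G G-freq G⊥squares)
    (subst (λ N → suc w ∣ n * N) N≡M+λ₁ (blockSizes⇒∣ w sizes))))
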